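{- Let $\mathcal{P}\subseteq\widehat{\mathcal{G}}_2$ be the closure of the set of finite rooted paths, with the metric $\rho$. Let $\alpha\mathbb{N}=\{1/n: n\in\mathbb{N},\ n\ge1\}\cup\{0\}\subseteq\mathbb{R}$, and equip $\alpha\mathbb{N}^2$ with the $\ell_\infty$ distance $d_\infty((a,b),(a',b'))=\max\{|a-a'|,|b-b'|\}$. Then $(\mathcal{P},\rho)$ is homeomorphic to $(\alpha\mathbb{N}^2,d_\infty)$.
   Context: All graphs are simple; $\mathbb{N}=\{0,1,2,\dots\}$. A rooted graph $(G,o)$ has $o\in V(G)$; isomorphisms of rooted graphs map root to root; $[G,o]$ is the isomorphism class. $\widehat{\mathcal{G}}_2$ is the set of isomorphism classes of connected rooted graphs of maximal degree at most $2$, with metric $\rho([G,o],[G',o'])=0$ if equal and otherwise $1/(1+r)$, where $r=\sup\{s\in\mathbb{N}:[B_G(o,s),o]=[B_{G'}(o',s),o']\}$ and $B_G(o,s)$ is the subgraph induced by vertices at graph distance $\le s$ from $o$. A finite rooted path is $[P_k,o]$ where $P_k$ is the path with $k\ge1$ vertices and $o\in V(P_k)$. The closure $\mathcal{P}$ consists of the finite rooted paths, the semi-infinite rooted paths (the subgraph of the integer line induced by $[N,\infty)\cap\mathbb{Z}$, $N\le0$, rooted at $0$), and the bi-infinite path (integers, consecutive ones adjacent). -}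

module Defs where

open import Level using (0ℓ)
open import Data.Nat as ℕ using (ℕ; zero; suc)
open import Data.Fin using (Fin; toℕ)
open import Data.Integer as ℤ using (ℤ; +_)
open import Data.Rational as ℚ using (ℚ; 0ℚ; _/_; _<_; _-_; _⊔_; ∣_∣)
open import Data.Product using (Σ; Σ-syntax; ∃; _×_; _,_; proj₁; proj₂)
open import Data.Sum using (_⊎_)
open import Data.Unit using (⊤)
open import Relation.Nullary using (¬_)
open import Relation.Binary.PropositionalEquality using (_≡_)

record RootedGraph : Set₁ where
  field
    V    : Set
    E    : V → V → Set
    root : V
open RootedGraph public

data Within (G : RootedGraph) : ℕ → V G → Set where
  at-root : ∀ {s} → Within G s (root G)
  step    : ∀ {s u v} → Within G s u → E G u v → Within G (suc s) v

-- Isomorphism of the rooted subgraphs induced by predicates PG, PH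
-- (which are assumed to contain the roots); roots go to roots.
record IsoOn (G H : RootedGraph) (PG : V G → Set) (PH : V H → Set) : Set where
  field
    to      : V G → V H
    from    : V H → V G
    to-in   : ∀ v → PG v → PH (to v)
    from-in : ∀ w → PH w → PG (from w)
    left    : ∀ v → PG v → from (to v) ≡ v
    right   : ∀ w → PH w → to (from w) ≡ w
    edge    : ∀ u v → PG u → PG v → E G u v → E H (to u) (to v)
    edge⁻   : ∀ u v → PH u → PH v → E H u v → E G (from u) (from v)
    root≡   : to (root G) ≡ root H

Iso : RootedGraph → RootedGraph → Set
Iso G H = IsoOn G H (λ _ → ⊤) (λ _ → ⊤)

BallIso : RootedGraph → RootedGraph → ℕ → Set
BallIso G H s = IsoOn G H (Within G s) (Within H s)

-- r is the supremum (a maximum) of {s : balls of radius s agree}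
IsSupRadius : RootedGraph → RootedGraph → ℕ → Set
IsSupRadius G H r = BallIso G H r × (∀ s → BallIso G H s → s ℕ.≤ r)

-- that set is unbounded (supremum = ∞)
UnboundedRadius : RootedGraph → RootedGraph → Set
UnboundedRadius G H = ∀ n → Σ[ s ∈ ℕ ] (n ℕ.≤ s × BallIso G H s)

-- Rho G H q : ρ([G,o],[H,o']) = q   (with 1/(1+∞) read as 0)
Rho : RootedGraph → RootedGraph → ℚ → Set
Rho G H q =
  (Iso G H × q ≡ 0ℚ)
  ⊎ (¬ Iso G H ×
      ((Σ[ r ∈ ℕ ] (IsSupRadius G H r × q ≡ (+ 1) / suc r))
       ⊎ (UnboundedRadius G H × q ≡ 0ℚ)))

data PElem : Set where
  -- finite rooted path [P_k, o] (k ≥ 1 since Fin k is inhabited)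
  finite   : (k : ℕ) → Fin k → PElem
  -- semi-infinite path on [N,∞) ∩ ℤ, N ≤ 0, rooted at 0
  semiInf  : (N : ℤ) → N ℤ.≤ + 0 → PElem
  biInf    : PElem

ℤAdj : ℤ → ℤ → Set
ℤAdj a b = (b ≡ a ℤ.+ + 1) ⊎ (a ≡ b ℤ.+ + 1)

toGraph : PElem → RootedGraph
toGraph (finite k o) = record
  { V = Fin k
  ; E = λ i j → (toℕ j ≡ suc (toℕ i)) ⊎ (toℕ i ≡ suc (toℕ j))
  ; root = o }
toGraph (semiInf N N≤0) = record
  { V = Σ[ z ∈ ℤ ] (N ℤ.≤ z)
  ; E = λ a b → ℤAdj (proj₁ a) (proj₁ b)
  ; root = (+ 0 , N≤0) }
toGraph biInf = record { V = ℤ ; E = ℤAdj ; root = + 0 }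

_≅_ : PElem → PElem → Set
x ≅ y = Iso (toGraph x) (toGraph y)

ρ≡ : PElem → PElem → ℚ → Set
ρ≡ x y q = Rho (toGraph x) (toGraph y) q

InαN : ℚ → Set
InαN q = (q ≡ 0ℚ) ⊎ (Σ[ n ∈ ℕ ] q ≡ (+ 1) / suc n)

αN² : Set
αN² = Σ[ p ∈ ℚ × ℚ ] (InαN (proj₁ p) × InαN (proj₂ p))

d∞ : αN² → αN² → ℚ
d∞ ((a , b) , _) ((a' , b') , _) = ∣ a - a' ∣ ⊔ ∣ b - b' ∣

-- Homeomorphism (𝒫, ρ) ≃ (αℕ², d∞); points of 𝒫 are taken up to ≅,
-- points of αℕ² up to equality of the underlying pair of rationals.

ContinuousP→α : (PElem → αN²) → Set
ContinuousP→α f = ∀ x (ε : ℚ) → 0ℚ < ε → Σ[ δ ∈ ℚ ] (0ℚ < δ ×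
  (∀ y q → ρ≡ x y q → q < δ → d∞ (f x) (f y) < ε))

Continuousα→P : (αN² → PElem) → Set
Continuousα→P g = ∀ a (ε : ℚ) → 0ℚ < ε → Σ[ δ ∈ ℚ ] (0ℚ < δ ×
  (∀ b → d∞ a b < δ → Σ[ q ∈ ℚ ] (ρ≡ (g a) (g b) q × q < ε)))

Homeomorphic : Set
Homeomorphic =
  Σ[ f ∈ (PElem → αN²) ] Σ[ g ∈ (αN² → PElem) ]
    ( (∀ x y → x ≅ y → proj₁ (f x) ≡ proj₁ (f y))
    × (∀ a b → proj₁ a ≡ proj₁ b → g a ≅ g b)
    × (∀ x → g (f x) ≅ x)
    × (∀ a → proj₁ (f (g a)) ≡ proj₁ a)
    × ContinuousP→α f
    × Continuousα→P g )

-- A rooted path is determined up to isomorphism by the distances L, R ∈ ℕ ∪ {∞} from its root to its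
-- two ends, up to swapping them, i.e. by the sorted pair m ≤ M of these distances; its ball of radius s is
-- the path with distances min(L, s), min(R, s). Hence two paths have isomorphic s-balls exactly when
-- their sorted pairs agree after truncation at s, and (𝒫, ρ) is homeomorphic to the triangle {m ≤ M}
-- in ℕ∞², where ℕ∞ = ℕ ∪ {∞} carries the topology of αℕ via n ↦ 1/(n+1), ∞ ↦ 0. Reading the parity
-- of m, the map (2i, M) ↦ (i, M - i), (2i+1, M) ↦ (M - i, i) is a homeomorphism of the triangle onto
-- the square ℕ∞²: agreement up to level 2K on the triangle gives agreement up to level K on the square,
-- and conversely points close enough to (u, v) in the square have preimages agreeing with the preimage
-- of (u, v) up to any prescribed level.

module Submission where

open import Defs
open import Data.Nat as ℕ using (ℕ; zero; suc; z≤n; s≤s; _⊓_; _⊔_; _∸_)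
import Data.Nat.Properties as ℕP
open import Data.Fin as Fin using (Fin; toℕ)
import Data.Fin.Properties as FinP
open import Data.Integer as ℤ using (ℤ; +_; -[1+_]; _⊖_)
import Data.Integer.Properties as ℤP
open import Data.Rational as ℚ using (ℚ; 0ℚ; _/_; mkℚ; _≤_; _<_; _-_; -_; *≤*; *<*)
  renaming (_⊓_ to _⊓ℚ_; ∣_∣ to ∣_∣ℚ)
import Data.Rational.Properties as ℚP
open import Algebra.Properties.Group ℚP.+-0-group using (⁻¹-anti-homo-//)
open import Data.Nat.Coprimality using (1-coprimeTo)
open import Data.Product using (Σ-syntax; _×_; _,_; proj₁; proj₂; swap)
open import Data.Sum using (_⊎_; inj₁; inj₂)
open import Data.Unit using (⊤; tt)
open import Data.Empty using (⊥; ⊥-elim)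
open import Relation.Nullary using (¬_; Dec; yes; no)
open import Relation.Binary.PropositionalEquality
open import Relation.Binary.Definitions using (tri<; tri≈; tri>)

data ℕ∞ : Set where
  fin : ℕ → ℕ∞
  ∞   : ℕ∞

fin-injective : ∀ {a b} → fin a ≡ fin b → a ≡ b
fin-injective refl = refl

_≟∞_ : (x y : ℕ∞) → Dec (x ≡ y)
fin a ≟∞ fin b with a ℕ.≟ b
... | yes refl = yes refl
... | no a≢b   = no (λ eq → a≢b (fin-injective eq))
fin a ≟∞ ∞     = no (λ ())
∞     ≟∞ fin b = no (λ ())
∞     ≟∞ ∞     = yes refl

infix 4 _≤∞_ _≤∞?_

_≤∞_ : ℕ → ℕ∞ → Set
n ≤∞ fin b = n ℕ.≤ b
n ≤∞ ∞     = ⊤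

_≤∞?_ : ∀ n x → Dec (n ≤∞ x)
n ≤∞? fin b = n ℕ.≤? b
n ≤∞? ∞     = yes tt

z≤∞ : ∀ x → 0 ≤∞ x
z≤∞ (fin b) = z≤n
z≤∞ ∞       = tt

≤-≤∞-trans : ∀ {m n} x → m ℕ.≤ n → n ≤∞ x → m ≤∞ x
≤-≤∞-trans (fin b) m≤n n≤b = ℕP.≤-trans m≤n n≤b
≤-≤∞-trans ∞       _   _   = tt

min∞ max∞ : ℕ∞ → ℕ∞ → ℕ∞
min∞ (fin a) (fin b) = fin (a ⊓ b)
min∞ (fin a) ∞       = fin a
min∞ ∞       y       = y
max∞ (fin a) (fin b) = fin (a ⊔ b)
max∞ (fin a) ∞       = ∞
max∞ ∞       y       = ∞

≤∞-min∞ : ∀ {n} x y → n ≤∞ x → n ≤∞ y → n ≤∞ min∞ x y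
≤∞-min∞ (fin a) (fin b) p q = ℕP.⊓-glb p q
≤∞-min∞ (fin a) ∞       p q = p
≤∞-min∞ ∞       y       p q = q

≤∞-min∞⁻ : ∀ {n} x y → n ≤∞ min∞ x y → n ≤∞ x × n ≤∞ y
≤∞-min∞⁻ (fin a) (fin b) p = ℕP.≤-trans p (ℕP.m⊓n≤m a b) , ℕP.≤-trans p (ℕP.m⊓n≤n a b)
≤∞-min∞⁻ (fin a) ∞       p = p , tt
≤∞-min∞⁻ ∞       y       p = tt , p

min∞≡∞⁻ : ∀ x y → min∞ x y ≡ ∞ → x ≡ ∞ × y ≡ ∞
min∞≡∞⁻ (fin a) (fin b) ()
min∞≡∞⁻ (fin a) ∞       ()
min∞≡∞⁻ ∞       y       eq = refl , eq

infixl 8 _⊓∞_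

_⊓∞_ : ℕ∞ → ℕ → ℕ
fin a ⊓∞ s = a ⊓ s
∞     ⊓∞ s = s

x⊓∞s≤s : ∀ x s → x ⊓∞ s ℕ.≤ s
x⊓∞s≤s (fin a) s = ℕP.m⊓n≤n a s
x⊓∞s≤s ∞       s = ℕP.≤-refl

s≤∞x⇒x⊓∞s≡s : ∀ x {s} → s ≤∞ x → x ⊓∞ s ≡ s
s≤∞x⇒x⊓∞s≡s (fin a) s≤a = ℕP.m≥n⇒m⊓n≡n s≤a
s≤∞x⇒x⊓∞s≡s ∞       _   = refl

x⊓∞s≡s⇒s≤∞x : ∀ x {s} → x ⊓∞ s ≡ s → s ≤∞ x
x⊓∞s≡s⇒s≤∞x (fin a) {s} eq = subst (ℕ._≤ a) eq (ℕP.m⊓n≤m a s)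
x⊓∞s≡s⇒s≤∞x ∞       _      = tt

x⊓∞s<s⇒x≡fin : ∀ x {s} → x ⊓∞ s ℕ.< s → x ≡ fin (x ⊓∞ s)
x⊓∞s<s⇒x≡fin (fin a) {s} lt with a ℕ.≤? s
... | yes a≤s = cong fin (sym (ℕP.m≤n⇒m⊓n≡m a≤s))
... | no  a≰s = ⊥-elim (ℕP.<-irrefl (ℕP.m≥n⇒m⊓n≡n (ℕP.<⇒≤ (ℕP.≰⇒> a≰s))) lt)
x⊓∞s<s⇒x≡fin ∞ lt = ⊥-elim (ℕP.<-irrefl refl lt)

⊓∞-glb : ∀ x {n s} → n ≤∞ x → n ℕ.≤ s → n ℕ.≤ x ⊓∞ s
⊓∞-glb (fin a) p q = ℕP.⊓-glb p q
⊓∞-glb ∞       p q = q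

≤⊓∞⇒≤∞ : ∀ x {n s} → n ℕ.≤ x ⊓∞ s → n ≤∞ x
≤⊓∞⇒≤∞ (fin a) {s = s} p = ℕP.≤-trans p (ℕP.m⊓n≤m a s)
≤⊓∞⇒≤∞ ∞       p         = tt

min∞-⊓∞ : ∀ x y s → min∞ x y ⊓∞ s ≡ (x ⊓∞ s) ⊓ (y ⊓∞ s)
min∞-⊓∞ (fin a) (fin b) s = ⊓-distribʳ-⊓ a b s
  where
    ⊓-distribʳ-⊓ : ∀ a b s → (a ⊓ b) ⊓ s ≡ (a ⊓ s) ⊓ (b ⊓ s)
    ⊓-distribʳ-⊓ a b s = begin
      (a ⊓ b) ⊓ s         ≡⟨ cong ((a ⊓ b) ⊓_) (sym (ℕP.⊓-idem s)) ⟩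
      (a ⊓ b) ⊓ (s ⊓ s)   ≡⟨ ℕP.⊓-assoc a b (s ⊓ s) ⟩
      a ⊓ (b ⊓ (s ⊓ s))   ≡⟨ cong (a ⊓_) (ℕP.⊓-comm b (s ⊓ s)) ⟩
      a ⊓ ((s ⊓ s) ⊓ b)   ≡⟨ cong (a ⊓_) (ℕP.⊓-assoc s s b) ⟩
      a ⊓ (s ⊓ (s ⊓ b))   ≡⟨ sym (ℕP.⊓-assoc a s (s ⊓ b)) ⟩
      (a ⊓ s) ⊓ (s ⊓ b)   ≡⟨ cong ((a ⊓ s) ⊓_) (ℕP.⊓-comm s b) ⟩
      (a ⊓ s) ⊓ (b ⊓ s)   ∎
      where open ≡-Reasoning
min∞-⊓∞ (fin a) ∞       s = sym (ℕP.m≤n⇒m⊓n≡m (ℕP.m⊓n≤n a s))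
min∞-⊓∞ ∞       (fin b) s = sym (ℕP.m≥n⇒m⊓n≡n (ℕP.m⊓n≤n b s))
min∞-⊓∞ ∞       ∞       s = sym (ℕP.⊓-idem s)

max∞-⊓∞ : ∀ x y s → max∞ x y ⊓∞ s ≡ (x ⊓∞ s) ⊔ (y ⊓∞ s)
max∞-⊓∞ (fin a) (fin b) s = ℕP.⊓-distribʳ-⊔ s a b
max∞-⊓∞ (fin a) ∞       s = sym (ℕP.m≤n⇒m⊔n≡n (ℕP.m⊓n≤n a s))
max∞-⊓∞ ∞       (fin b) s = sym (ℕP.m≥n⇒m⊔n≡m (ℕP.m⊓n≤n b s))
max∞-⊓∞ ∞       ∞       s = sym (ℕP.⊔-idem s)

Agree : ℕ → ℕ∞ → ℕ∞ → Set
Agree s x y = x ⊓∞ s ≡ y ⊓∞ s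

≤∞⇒agree : ∀ x y {s} → s ≤∞ x → s ≤∞ y → Agree s x y
≤∞⇒agree x y p q = trans (s≤∞x⇒x⊓∞s≡s x p) (sym (s≤∞x⇒x⊓∞s≡s y q))

agree⇒≡⊎≤∞ : ∀ x y {s} → Agree s x y → x ≡ y ⊎ (s ≤∞ x × s ≤∞ y)
agree⇒≡⊎≤∞ x y {s} eq with ℕP.m≤n⇒m<n∨m≡n (x⊓∞s≤s x s)
... | inj₁ lt = inj₁ (begin
  x               ≡⟨ x⊓∞s<s⇒x≡fin x lt ⟩
  fin (x ⊓∞ s)    ≡⟨ cong fin eq ⟩
  fin (y ⊓∞ s)    ≡⟨ sym (x⊓∞s<s⇒x≡fin y (subst (ℕ._< s) eq lt)) ⟩
  y               ∎)
  where open ≡-Reasoning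
... | inj₂ x⊓∞s≡s = inj₂ (x⊓∞s≡s⇒s≤∞x x x⊓∞s≡s , x⊓∞s≡s⇒s≤∞x y (trans (sym eq) x⊓∞s≡s))

agree-mono : ∀ x y {s t} → t ℕ.≤ s → Agree s x y → Agree t x y
agree-mono x y t≤s eq with agree⇒≡⊎≤∞ x y eq
... | inj₁ refl    = refl
... | inj₂ (p , q) = ≤∞⇒agree x y (≤-≤∞-trans x t≤s p) (≤-≤∞-trans y t≤s q)

agree-all⇒≡ : ∀ x y → (∀ s → Agree s x y) → x ≡ y
agree-all⇒≡ (fin a) (fin b) agree = cong fin (begin
  a               ≡⟨ sym (ℕP.m≤n⇒m⊓n≡m (ℕP.m≤m+n a b)) ⟩
  a ⊓ (a ℕ.+ b)   ≡⟨ agree (a ℕ.+ b) ⟩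
  b ⊓ (a ℕ.+ b)   ≡⟨ ℕP.m≤n⇒m⊓n≡m (ℕP.m≤n+m b a) ⟩
  b               ∎)
  where open ≡-Reasoning
agree-all⇒≡ (fin a) ∞       agree = ⊥-elim (ℕP.1+n≰n (x⊓∞s≡s⇒s≤∞x (fin a) (agree (suc a))))
agree-all⇒≡ ∞       (fin b) agree = ⊥-elim (ℕP.1+n≰n (x⊓∞s≡s⇒s≤∞x (fin b) (sym (agree (suc b)))))
agree-all⇒≡ ∞       ∞       _     = refl

agreementLevel : ℕ∞ → ℕ∞ → ℕ∞
agreementLevel x y with x ≟∞ y
... | yes _ = ∞
... | no  _ = min∞ x y

agree⇒≤∞level : ∀ x y {s} → Agree s x y → s ≤∞ agreementLevel x y
agree⇒≤∞level x y agree with x ≟∞ y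
... | yes _   = tt
... | no  x≢y with agree⇒≡⊎≤∞ x y agree
...   | inj₁ x≡y     = ⊥-elim (x≢y x≡y)
...   | inj₂ (p , q) = ≤∞-min∞ x y p q

≤∞level⇒agree : ∀ x y {s} → s ≤∞ agreementLevel x y → Agree s x y
≤∞level⇒agree x y s≤l with x ≟∞ y
... | yes refl = refl
... | no  _    = let p , q = ≤∞-min∞⁻ x y s≤l in ≤∞⇒agree x y p q

level≡∞⇒≡ : ∀ x y → agreementLevel x y ≡ ∞ → x ≡ y
level≡∞⇒≡ x y l≡∞ with x ≟∞ y
... | yes x≡y = x≡y
... | no  _   = let x≡∞ , y≡∞ = min∞≡∞⁻ x y l≡∞ in trans x≡∞ (sym y≡∞)

ℕ∞² : Set
ℕ∞² = ℕ∞ × ℕ∞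

Agree² : ℕ → ℕ∞² → ℕ∞² → Set
Agree² s (x , y) (x' , y') = Agree s x x' × Agree s y y'

agree²-mono : ∀ P Q {s t} → t ℕ.≤ s → Agree² s P Q → Agree² t P Q
agree²-mono (x , y) (x' , y') t≤s (a , b) = agree-mono x x' t≤s a , agree-mono y y' t≤s b

agree²-all⇒≡ : ∀ P Q → (∀ s → Agree² s P Q) → P ≡ Q
agree²-all⇒≡ (x , y) (x' , y') agree =
  cong₂ _,_ (agree-all⇒≡ x x' (λ s → proj₁ (agree s))) (agree-all⇒≡ y y' (λ s → proj₂ (agree s)))

agreementLevel² : ℕ∞² → ℕ∞² → ℕ∞
agreementLevel² (x , y) (x' , y') = min∞ (agreementLevel x x') (agreementLevel y y')

agree²⇒≤∞level² : ∀ P Q {s} → Agree² s P Q → s ≤∞ agreementLevel² P Q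
agree²⇒≤∞level² (x , y) (x' , y') (a , b) =
  ≤∞-min∞ (agreementLevel x x') (agreementLevel y y') (agree⇒≤∞level x x' a) (agree⇒≤∞level y y' b)

≤∞level²⇒agree² : ∀ P Q {s} → s ≤∞ agreementLevel² P Q → Agree² s P Q
≤∞level²⇒agree² (x , y) (x' , y') s≤l =
  let p , q = ≤∞-min∞⁻ (agreementLevel x x') (agreementLevel y y') s≤l
  in ≤∞level⇒agree x x' p , ≤∞level⇒agree y y' q

level²≡∞⇒≡ : ∀ P Q → agreementLevel² P Q ≡ ∞ → P ≡ Q
level²≡∞⇒≡ (x , y) (x' , y') l≡∞ =
  let p , q = min∞≡∞⁻ (agreementLevel x x') (agreementLevel y y') l≡∞
  in cong₂ _,_ (level≡∞⇒≡ x x' p) (level≡∞⇒≡ y y' q)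

Sorted : ℕ∞² → Set
Sorted (fin a , fin b) = a ℕ.≤ b
Sorted (fin a , ∞)     = ⊤
Sorted (∞     , fin b) = ⊥
Sorted (∞     , ∞)     = ⊤

sort : ℕ∞² → ℕ∞²
sort (x , y) = min∞ x y , max∞ x y

sort-sorted : ∀ P → Sorted (sort P)
sort-sorted (fin a , fin b) = ℕP.≤-trans (ℕP.m⊓n≤m a b) (ℕP.m≤m⊔n a b)
sort-sorted (fin a , ∞)     = tt
sort-sorted (∞     , fin b) = tt
sort-sorted (∞     , ∞)     = tt

sorted⇒sort≡id : ∀ P → Sorted P → sort P ≡ P
sorted⇒sort≡id (fin a , fin b) a≤b =
  cong₂ (λ u v → fin u , fin v) (ℕP.m≤n⇒m⊓n≡m a≤b) (ℕP.m≤n⇒m⊔n≡n a≤b)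
sorted⇒sort≡id (fin a , ∞)     _ = refl
sorted⇒sort≡id (∞     , ∞)     _ = refl

sort≡id⊎swap : ∀ P → sort P ≡ P ⊎ sort P ≡ swap P
sort≡id⊎swap (fin a , fin b) with ℕP.≤-total a b
... | inj₁ a≤b = inj₁ (sorted⇒sort≡id (fin a , fin b) a≤b)
... | inj₂ b≤a = inj₂ (cong₂ (λ u v → fin u , fin v) (ℕP.m≥n⇒m⊓n≡n b≤a) (ℕP.m≥n⇒m⊔n≡m b≤a))
sort≡id⊎swap (fin a , ∞)     = inj₁ refl
sort≡id⊎swap (∞     , fin b) = inj₂ refl
sort≡id⊎swap (∞     , ∞)     = inj₁ refl

sorted⇒≤∞ : ∀ P → Sorted P → ∀ {n} → n ≤∞ proj₁ P → n ≤∞ proj₂ P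
sorted⇒≤∞ (fin a , fin b) a≤b n≤a = ℕP.≤-trans n≤a a≤b
sorted⇒≤∞ (fin a , ∞)     _   _   = tt
sorted⇒≤∞ (∞     , ∞)     _   _   = tt

open IsoOn

Iso-refl : ∀ G → Iso G G
Iso-refl G = record
  { to = λ v → v ; from = λ v → v ; to-in = λ _ _ → tt ; from-in = λ _ _ → tt
  ; left = λ _ _ → refl ; right = λ _ _ → refl
  ; edge = λ _ _ _ _ e → e ; edge⁻ = λ _ _ _ _ e → e ; root≡ = refl }

IsoOn-sym : ∀ {G H PG PH} → PG (root G) → IsoOn G H PG PH → IsoOn H G PH PG
IsoOn-sym root∈PG I = record
  { to = from I ; from = to I ; to-in = from-in I ; from-in = to-in I
  ; left = right I ; right = left I ; edge = edge⁻ I ; edge⁻ = edge I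
  ; root≡ = trans (cong (from I) (sym (root≡ I))) (left I _ root∈PG) }

Within-mono : ∀ {G s t v} → s ℕ.≤ t → Within G s v → Within G t v
Within-mono _         at-root    = at-root
Within-mono (s≤s s≤t) (step w e) = step (Within-mono s≤t w) e

Iso⇒BallIso : ∀ {G H} → Iso G H → ∀ s → BallIso G H s
Iso⇒BallIso {G} {H} I s = record
  { to = to I ; from = from I
  ; to-in = λ _ w → transport I w
  ; from-in = λ _ w → transport (IsoOn-sym tt I) w
  ; left = λ v _ → left I v tt ; right = λ w _ → right I w tt
  ; edge = λ u v _ _ e → edge I u v tt tt e
  ; edge⁻ = λ u v _ _ e → edge⁻ I u v tt tt e
  ; root≡ = root≡ I }
  where
    transport : ∀ {G H} (I : Iso G H) {s v} → Within G s v → Within H s (to I v)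
    transport I at-root    = subst (Within _ _) (sym (root≡ I)) at-root
    transport I (step w e) = step (transport I w) (edge I _ _ tt tt e)

BallIso-within : ∀ {G H s} (I : BallIso G H s) {t v} → t ℕ.≤ s → Within G t v → Within H t (to I v)
BallIso-within I t≤s at-root = subst (Within _ _) (sym (root≡ I)) at-root
BallIso-within I {suc t} t≤s (step {u = u} {v = v} w e) =
  step (BallIso-within I t<s w) (edge I u v (Within-mono t<s w) (Within-mono t≤s (step w e)) e)
  where t<s = ℕP.≤-trans (ℕP.n≤1+n t) t≤s

-- Profile (L , R) stands for the integer interval [-L, R].
InInterval : ℕ∞² → ℤ → Set
InInterval (L , R) (+ n)    = n ≤∞ R
InInterval (L , R) -[1+ n ] = suc n ≤∞ L

InInterval? : ∀ P z → Dec (InInterval P z)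
InInterval? (L , R) (+ n)    = n ≤∞? R
InInterval? (L , R) -[1+ n ] = suc n ≤∞? L

0∈Interval : ∀ P → InInterval P (+ 0)
0∈Interval (L , R) = z≤∞ R

truncate : ℕ → ℕ∞² → ℕ∞²
truncate s (L , R) = fin (L ⊓∞ s) , fin (R ⊓∞ s)

InInterval-truncate⁻ : ∀ s P z → InInterval (truncate s P) z → InInterval P z
InInterval-truncate⁻ s (L , R) (+ n)    p = ≤⊓∞⇒≤∞ R p
InInterval-truncate⁻ s (L , R) -[1+ n ] p = ≤⊓∞⇒≤∞ L p

record PathLike (G : RootedGraph) (P : ℕ∞²) : Set where
  field
    pos      : V G → ℤ
    pos-inj  : ∀ u v → pos u ≡ pos v → u ≡ v
    adj→     : ∀ u v → E G u v → ℤAdj (pos u) (pos v)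
    adj←     : ∀ u v → ℤAdj (pos u) (pos v) → E G u v
    pos-root : pos (root G) ≡ + 0
    inR      : ∀ v → InInterval P (pos v)
    at       : ∀ z → InInterval P z → V G
    pos-at   : ∀ z p → pos (at z p) ≡ z
open PathLike

ℤAdj⇒∣b∣≤1+∣a∣ : ∀ a b → ℤAdj a b → ℤ.∣ b ∣ ℕ.≤ suc ℤ.∣ a ∣
ℤAdj⇒∣b∣≤1+∣a∣ a .(a ℤ.+ + 1) (inj₁ refl) = ∣a+1∣≤1+∣a∣ a
  where
    ∣a+1∣≤1+∣a∣ : ∀ a → ℤ.∣ a ℤ.+ + 1 ∣ ℕ.≤ suc ℤ.∣ a ∣
    ∣a+1∣≤1+∣a∣ (+ n)          = ℕP.≤-reflexive (ℕP.+-comm n 1)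
    ∣a+1∣≤1+∣a∣ -[1+ zero ]    = z≤n
    ∣a+1∣≤1+∣a∣ -[1+ suc n ]   = ℕP.≤-trans (ℕP.n≤1+n (suc n)) (ℕP.n≤1+n (suc (suc n)))
ℤAdj⇒∣b∣≤1+∣a∣ .(b ℤ.+ + 1) b (inj₂ refl) = ∣b∣≤1+∣b+1∣ b
  where
    ∣b∣≤1+∣b+1∣ : ∀ b → ℤ.∣ b ∣ ℕ.≤ suc ℤ.∣ b ℤ.+ + 1 ∣
    ∣b∣≤1+∣b+1∣ (+ n)          = ℕP.≤-trans (ℕP.m≤m+n n 1) (ℕP.n≤1+n _)
    ∣b∣≤1+∣b+1∣ -[1+ zero ]    = ℕP.≤-refl
    ∣b∣≤1+∣b+1∣ -[1+ suc n ]   = ℕP.≤-refl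

module PathLikeProperties {G : RootedGraph} {P : ℕ∞²} (A : PathLike G P) where

  ∣pos∣≤ : ∀ {s v} → Within G s v → ℤ.∣ pos A v ∣ ℕ.≤ s
  ∣pos∣≤ at-root = ℕP.≤-trans (ℕP.≤-reflexive (cong ℤ.∣_∣ (pos-root A))) z≤n
  ∣pos∣≤ (step {u = u} {v = v} w e) =
    ℕP.≤-trans (ℤAdj⇒∣b∣≤1+∣a∣ _ _ (adj→ A u v e)) (s≤s (∣pos∣≤ w))

  at-pos : ∀ v z p → pos A v ≡ z → at A z p ≡ v
  at-pos v z p eq = pos-inj A _ _ (trans (pos-at A z p) (sym eq))

  at-adjacent : ∀ z p z' p' → ℤAdj z z' → E G (at A z p) (at A z' p')
  at-adjacent z p z' p' adj = adj← A _ _ (subst₂ ℤAdj (sym (pos-at A z p)) (sym (pos-at A z' p')) adj)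

  within-at : ∀ z p → Within G ℤ.∣ z ∣ (at A z p)
  within-at (+ zero) p = subst (Within G 0) (sym (at-pos (root G) (+ 0) p (pos-root A))) at-root
  within-at (+ (suc n)) p =
    step (within-at (+ n) p') (at-adjacent (+ n) p' (+ (suc n)) p (inj₁ (cong +_ (ℕP.+-comm 1 n))))
    where p' = ≤-≤∞-trans (proj₂ P) (ℕP.n≤1+n n) p
  within-at -[1+ zero ] p =
    step (within-at (+ 0) (0∈Interval P)) (at-adjacent (+ 0) (0∈Interval P) -[1+ 0 ] p (inj₂ refl))
  within-at -[1+ suc n ] p =
    step (within-at -[1+ n ] p') (at-adjacent -[1+ n ] p' -[1+ suc n ] p (inj₂ refl))
    where p' = ≤-≤∞-trans (proj₁ P) (ℕP.n≤1+n (suc n)) p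

  ∣pos∣≤⇒within : ∀ {s} v → ℤ.∣ pos A v ∣ ℕ.≤ s → Within G s v
  ∣pos∣≤⇒within v le =
    Within-mono le (subst (Within G _) (at-pos v (pos A v) (inR A v) refl) (within-at (pos A v) (inR A v)))

  within⇒InInterval : ∀ {s v} → Within G s v → InInterval (truncate s P) (pos A v)
  within⇒InInterval {s} {v} w with pos A v | inR A v | ∣pos∣≤ w
  ... | + n      | p | n≤s = ⊓∞-glb (proj₂ P) p n≤s
  ... | -[1+ n ] | p | n≤s = ⊓∞-glb (proj₁ P) p n≤s

open PathLikeProperties

module Transport {G H : RootedGraph} {P Q : ℕ∞²} (A : PathLike G P) (B : PathLike H Q) where

  -- The root is a junk value for vertices outside Q's interval.
  transport : V G → V H
  transport v with InInterval? Q (pos A v)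
  ... | yes p = at B (pos A v) p
  ... | no  _ = root H

  pos-transport : ∀ v → InInterval Q (pos A v) → pos B (transport v) ≡ pos A v
  pos-transport v p with InInterval? Q (pos A v)
  ... | yes p' = pos-at B (pos A v) p'
  ... | no  ¬p = ⊥-elim (¬p p)

  transport-adjacent : ∀ u v → InInterval Q (pos A u) → InInterval Q (pos A v) →
                       E G u v → E H (transport u) (transport v)
  transport-adjacent u v u∈ v∈ e =
    adj← B _ _ (subst₂ ℤAdj (sym (pos-transport u u∈)) (sym (pos-transport v v∈)) (adj→ A u v e))

  transport-root : transport (root G) ≡ root H
  transport-root = pos-inj B _ _ (begin
    pos B (transport (root G)) ≡⟨ pos-transport (root G) (subst (InInterval Q) (sym (pos-root A)) (0∈Interval Q)) ⟩
    pos A (root G)             ≡⟨ pos-root A ⟩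
    + 0                        ≡⟨ sym (pos-root B) ⟩
    pos B (root H)             ∎)
    where open ≡-Reasoning

open Transport

transport-transport : ∀ {G H P Q} (A : PathLike G P) (B : PathLike H Q) v → InInterval Q (pos A v) →
                      transport B A (transport A B v) ≡ v
transport-transport {P = P} A B v v∈ = pos-inj A _ _ (trans back there)
  where
    there = pos-transport A B v v∈
    back  = pos-transport B A (transport A B v) (subst (InInterval P) (sym there) (inR A v))

pathLike⇒IsoOn : ∀ {G H P Q} (A : PathLike G P) (B : PathLike H Q)
  (PG : V G → Set) (PH : V H → Set) →
  (∀ v → PG v → InInterval Q (pos A v)) → (∀ w → PH w → InInterval P (pos B w)) →
  (∀ v w → pos B w ≡ pos A v → PG v → PH w) → (∀ w v → pos A v ≡ pos B w → PH w → PG v) →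
  IsoOn G H PG PH
pathLike⇒IsoOn A B PG PH G→Q H→P G→H H→G = record
  { to      = transport A B
  ; from    = transport B A
  ; to-in   = λ v v∈ → G→H v _ (pos-transport A B v (G→Q v v∈)) v∈
  ; from-in = λ w w∈ → H→G w _ (pos-transport B A w (H→P w w∈)) w∈
  ; left    = λ v v∈ → transport-transport A B v (G→Q v v∈)
  ; right   = λ w w∈ → transport-transport B A w (H→P w w∈)
  ; edge    = λ u v u∈ v∈ → transport-adjacent A B u v (G→Q u u∈) (G→Q v v∈)
  ; edge⁻   = λ u v u∈ v∈ → transport-adjacent B A u v (H→P u u∈) (H→P v v∈)
  ; root≡   = transport-root A B }

pathLike⇒Iso : ∀ {G H P} → PathLike G P → PathLike H P → Iso G H
pathLike⇒Iso A B =
  pathLike⇒IsoOn A B _ _ (λ v _ → inR A v) (λ w _ → inR B w) (λ _ _ _ _ → tt) (λ _ _ _ _ → tt)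

pathLike⇒BallIso : ∀ {G H P Q} → PathLike G P → PathLike H Q →
                   ∀ s → truncate s P ≡ truncate s Q → BallIso G H s
pathLike⇒BallIso {G} {H} {P} {Q} A B s eq = pathLike⇒IsoOn A B (Within G s) (Within H s)
  (λ v w → InInterval-truncate⁻ s Q (pos A v) (subst (λ X → InInterval X (pos A v)) eq (within⇒InInterval A w)))
  (λ v w → InInterval-truncate⁻ s P (pos B v)
             (subst (λ X → InInterval X (pos B v)) (sym eq) (within⇒InInterval B w)))
  (λ v w eq' wv → ∣pos∣≤⇒within B w (subst (λ z → ℤ.∣ z ∣ ℕ.≤ s) (sym eq') (∣pos∣≤ A wv)))
  (λ w v eq' ww → ∣pos∣≤⇒within A v (subst (λ z → ℤ.∣ z ∣ ℕ.≤ s) (sym eq') (∣pos∣≤ B ww)))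

ℤAdj-neg : ∀ a b → ℤAdj a b → ℤAdj (ℤ.- a) (ℤ.- b)
ℤAdj-neg a .(a ℤ.+ + 1) (inj₁ refl) = inj₂ (-a≡-[a+1]+1 a)
  where
    -a≡-[a+1]+1 : ∀ a → ℤ.- a ≡ ℤ.- (a ℤ.+ + 1) ℤ.+ + 1
    -a≡-[a+1]+1 a = sym (begin
      ℤ.- (a ℤ.+ + 1) ℤ.+ + 1         ≡⟨ cong (ℤ._+ + 1) (ℤP.neg-distrib-+ a (+ 1)) ⟩
      (ℤ.- a ℤ.+ -[1+ 0 ]) ℤ.+ + 1    ≡⟨ ℤP.+-assoc (ℤ.- a) -[1+ 0 ] (+ 1) ⟩
      ℤ.- a ℤ.+ + 0                   ≡⟨ ℤP.+-identityʳ (ℤ.- a) ⟩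
      ℤ.- a                           ∎)
      where open ≡-Reasoning
ℤAdj-neg .(b ℤ.+ + 1) b (inj₂ refl) = ℤAdj-symmetric (ℤAdj-neg b (b ℤ.+ + 1) (inj₁ refl))
  where
    ℤAdj-symmetric : ∀ {a b} → ℤAdj a b → ℤAdj b a
    ℤAdj-symmetric (inj₁ eq) = inj₂ eq
    ℤAdj-symmetric (inj₂ eq) = inj₁ eq

InInterval-neg : ∀ L R z → InInterval (L , R) z → InInterval (R , L) (ℤ.- z)
InInterval-neg L R (+ zero)    p = z≤∞ L
InInterval-neg L R (+ (suc n)) p = p
InInterval-neg L R -[1+ n ]    p = p

reflect : ∀ {G L R} → PathLike G (L , R) → PathLike G (R , L)
reflect {G} {L} {R} A = record
  { pos      = λ v → ℤ.- pos A v
  ; pos-inj  = λ u v eq → pos-inj A u v (ℤP.neg-injective eq)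
  ; adj→     = λ u v e → ℤAdj-neg _ _ (adj→ A u v e)
  ; adj←     = λ u v adj → adj← A u v
      (subst₂ ℤAdj (ℤP.neg-involutive (pos A u)) (ℤP.neg-involutive (pos A v)) (ℤAdj-neg _ _ adj))
  ; pos-root = cong ℤ.-_ (pos-root A)
  ; inR      = λ v → InInterval-neg L R (pos A v) (inR A v)
  ; at       = λ z p → at A (ℤ.- z) (InInterval-neg R L z p)
  ; pos-at   = λ z p → trans (cong ℤ.-_ (pos-at A (ℤ.- z) _)) (ℤP.neg-involutive z) }

InInterval⇒∣z∣≤⊔ : ∀ a b z → InInterval (fin a , fin b) z → ℤ.∣ z ∣ ℕ.≤ a ⊔ b
InInterval⇒∣z∣≤⊔ a b (+ n)    n≤b  = ℕP.≤-trans n≤b (ℕP.m≤n⊔m a b)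
InInterval⇒∣z∣≤⊔ a b -[1+ n ] 1+n≤a = ℕP.≤-trans 1+n≤a (ℕP.m≤m⊔n a b)

InInterval-∣z∣≡1+⊓-unique : ∀ a b z z' → InInterval (fin a , fin b) z → InInterval (fin a , fin b) z' →
                            ℤ.∣ z ∣ ≡ suc (a ⊓ b) → ℤ.∣ z' ∣ ≡ suc (a ⊓ b) → z ≡ z'
InInterval-∣z∣≡1+⊓-unique a b (+ n) (+ n') _ _ eq eq' = cong +_ (trans eq (sym eq'))
InInterval-∣z∣≡1+⊓-unique a b -[1+ n ] -[1+ n' ] _ _ eq eq' =
  cong -[1+_] (ℕP.suc-injective (trans eq (sym eq')))
InInterval-∣z∣≡1+⊓-unique a b (+ n) -[1+ n' ] p p' eq eq' =
  ⊥-elim (ℕP.1+n≰n (ℕP.⊓-glb (subst (ℕ._≤ a) eq' p') (subst (ℕ._≤ b) eq p)))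
InInterval-∣z∣≡1+⊓-unique a b -[1+ n ] (+ n') p p' eq eq' =
  ⊥-elim (ℕP.1+n≰n (ℕP.⊓-glb (subst (ℕ._≤ a) eq p) (subst (ℕ._≤ b) eq' p')))

InInterval-truncate⇒∣z∣≤ : ∀ s P z → InInterval (truncate s P) z → ℤ.∣ z ∣ ℕ.≤ s
InInterval-truncate⇒∣z∣≤ s (L , R) (+ n)    p = ℕP.≤-trans p (x⊓∞s≤s R s)
InInterval-truncate⇒∣z∣≤ s (L , R) -[1+ n ] p = ℕP.≤-trans p (x⊓∞s≤s L s)

∣pos∘to∣≤∣pos∣ : ∀ {G H P Q s} (A : PathLike G P) (B : PathLike H Q) (I : BallIso G H s) →
                 ∀ {v} → Within G s v → ℤ.∣ pos B (to I v) ∣ ℕ.≤ ℤ.∣ pos A v ∣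
∣pos∘to∣≤∣pos∣ A B I {v} w = ∣pos∣≤ B (BallIso-within I (∣pos∣≤ A w) (∣pos∣≤⇒within A v ℕP.≤-refl))

∣pos∘to∣≡∣pos∣ : ∀ {G H P Q s} (A : PathLike G P) (B : PathLike H Q) (I : BallIso G H s) →
                 ∀ {v} → Within G s v → ℤ.∣ pos B (to I v) ∣ ≡ ℤ.∣ pos A v ∣
∣pos∘to∣≡∣pos∣ A B I {v} w = ℕP.≤-antisym (∣pos∘to∣≤∣pos∣ A B I w)
  (subst (λ u → ℤ.∣ pos A u ∣ ℕ.≤ ℤ.∣ pos B (to I v) ∣) (left I v w)
         (∣pos∘to∣≤∣pos∣ B A (IsoOn-sym at-root I) (to-in I v w)))

-- The s-ball of a path-like graph with profile (L , R) is the interval [-a, b], a = L ⊓∞ s, b = R ⊓∞ s.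
-- A ball isomorphism preserves the distance to the root, so it preserves max a b, the largest distance
-- occurring; and 1 + min a b is the least distance at which at most one vertex of the ball lies.
module BallIsoInvariant {G H L R L' R' s} (A : PathLike G (L , R)) (B : PathLike H (L' , R'))
                        (I : BallIso G H s) where
  a b a' b' : ℕ
  a  = L ⊓∞ s
  b  = R ⊓∞ s
  a' = L' ⊓∞ s
  b' = R' ⊓∞ s

  vertexAt : ∀ z → InInterval (fin a , fin b) z → V G
  vertexAt z z∈ = at A z (InInterval-truncate⁻ s (L , R) z z∈)

  vertexAt-within : ∀ z z∈ → Within G s (vertexAt z z∈)
  vertexAt-within z z∈ = ∣pos∣≤⇒within A _
    (subst (ℕ._≤ s) (sym (cong ℤ.∣_∣ (pos-at A z _))) (InInterval-truncate⇒∣z∣≤ s (L , R) z z∈))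

  ∣pos-image∣ : ∀ z z∈ → ℤ.∣ pos B (to I (vertexAt z z∈)) ∣ ≡ ℤ.∣ z ∣
  ∣pos-image∣ z z∈ = trans (∣pos∘to∣≡∣pos∣ A B I (vertexAt-within z z∈)) (cong ℤ.∣_∣ (pos-at A z _))

  image∈ : ∀ z z∈ → InInterval (fin a' , fin b') (pos B (to I (vertexAt z z∈)))
  image∈ z z∈ = within⇒InInterval B (to-in I _ (vertexAt-within z z∈))

  ∣z∣≤⊔' : ∀ z → InInterval (fin a , fin b) z → ℤ.∣ z ∣ ℕ.≤ a' ⊔ b'
  ∣z∣≤⊔' z z∈ = subst (ℕ._≤ a' ⊔ b') (∣pos-image∣ z z∈)
                 (InInterval⇒∣z∣≤⊔ a' b' (pos B (to I (vertexAt z z∈))) (image∈ z z∈))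

  ⊔≤⊔' : a ⊔ b ℕ.≤ a' ⊔ b'
  ⊔≤⊔' = ℕP.⊔-lub (leftEnd a ℕP.≤-refl) (∣z∣≤⊔' (+ b) ℕP.≤-refl)
    where
      leftEnd : ∀ n → n ℕ.≤ a → n ℕ.≤ a' ⊔ b'
      leftEnd zero    _     = z≤n
      leftEnd (suc n) 1+n≤a = ∣z∣≤⊔' -[1+ n ] 1+n≤a

  ⊓≤⊓' : a ⊓ b ℕ.≤ a' ⊓ b'
  ⊓≤⊓' with a ⊓ b ℕ.≤? a' ⊓ b'
  ... | yes le  = le
  ... | no  nle = ⊥-elim (+≢-[1+] (begin
      + m₊                           ≡⟨ sym (pos-at A _ _) ⟩
      pos A (vertexAt (+ m₊) m₊≤b)   ≡⟨ cong (pos A) sameVertex ⟩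
      pos A (vertexAt -[1+ m ] m₊≤a) ≡⟨ pos-at A _ _ ⟩
      -[1+ m ]                       ∎))
    where
      open ≡-Reasoning
      m = a' ⊓ b'
      m₊ = suc m
      m₊≤⊓ : m₊ ℕ.≤ a ⊓ b
      m₊≤⊓ = ℕP.≰⇒> nle
      m₊≤b = ℕP.≤-trans m₊≤⊓ (ℕP.m⊓n≤n a b)
      m₊≤a = ℕP.≤-trans m₊≤⊓ (ℕP.m⊓n≤m a b)
      sameImage : to I (vertexAt (+ m₊) m₊≤b) ≡ to I (vertexAt -[1+ m ] m₊≤a)
      sameImage = pos-inj B _ _ (InInterval-∣z∣≡1+⊓-unique a' b' _ _ (image∈ _ m₊≤b) (image∈ _ m₊≤a)
                                  (∣pos-image∣ _ m₊≤b) (∣pos-image∣ _ m₊≤a))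
      sameVertex : vertexAt (+ m₊) m₊≤b ≡ vertexAt -[1+ m ] m₊≤a
      sameVertex = begin
        vertexAt (+ m₊) m₊≤b                      ≡⟨ sym (left I _ (vertexAt-within _ m₊≤b)) ⟩
        from I (to I (vertexAt (+ m₊) m₊≤b))      ≡⟨ cong (from I) sameImage ⟩
        from I (to I (vertexAt -[1+ m ] m₊≤a))    ≡⟨ left I _ (vertexAt-within _ m₊≤a) ⟩
        vertexAt -[1+ m ] m₊≤a                    ∎
      +≢-[1+] : + m₊ ≢ -[1+ m ]
      +≢-[1+] ()

BallIso⇒agree-sorted : ∀ {G H P Q s} → PathLike G P → PathLike H Q → BallIso G H s →
                        Agree² s (sort P) (sort Q)
BallIso⇒agree-sorted {P = L , R} {Q = L' , R'} {s} A B I =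
  (begin
    min∞ L R ⊓∞ s                  ≡⟨ min∞-⊓∞ L R s ⟩
    (L ⊓∞ s) ⊓ (R ⊓∞ s)            ≡⟨ ℕP.≤-antisym (⊓≤⊓' A B I) (⊓≤⊓' B A I⁻¹) ⟩
    (L' ⊓∞ s) ⊓ (R' ⊓∞ s)          ≡⟨ sym (min∞-⊓∞ L' R' s) ⟩
    min∞ L' R' ⊓∞ s                ∎) ,
  (begin
    max∞ L R ⊓∞ s                  ≡⟨ max∞-⊓∞ L R s ⟩
    (L ⊓∞ s) ⊔ (R ⊓∞ s)            ≡⟨ ℕP.≤-antisym (⊔≤⊔' A B I) (⊔≤⊔' B A I⁻¹) ⟩
    (L' ⊓∞ s) ⊔ (R' ⊓∞ s)          ≡⟨ sym (max∞-⊓∞ L' R' s) ⟩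
    max∞ L' R' ⊓∞ s                ∎)
  where
    open ≡-Reasoning
    open BallIsoInvariant using (⊓≤⊓'; ⊔≤⊔')
    I⁻¹ = IsoOn-sym at-root I

-- The distances from the root to the left and to the right end.
profile : PElem → ℕ∞²
profile (finite k o)  = fin (toℕ o) , fin (k ∸ suc (toℕ o))
profile (semiInf N _) = fin ℤ.∣ N ∣ , ∞
profile biInf         = ∞ , ∞

pathLike-biInf : PathLike (toGraph biInf) (∞ , ∞)
pathLike-biInf = record
  { pos = λ z → z ; pos-inj = λ _ _ eq → eq ; adj→ = λ _ _ e → e ; adj← = λ _ _ e → e
  ; pos-root = refl ; inR = inR' ; at = λ z _ → z ; pos-at = λ _ _ → refl }
  where
    inR' : ∀ z → InInterval (∞ , ∞) z
    inR' (+ n)    = tt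
    inR' -[1+ n ] = tt

pathLike-semiInf : ∀ N N≤0 → PathLike (toGraph (semiInf N N≤0)) (fin ℤ.∣ N ∣ , ∞)
pathLike-semiInf N N≤0 = record
  { pos = proj₁ ; pos-inj = pos-inj' ; adj→ = λ _ _ e → e ; adj← = λ _ _ e → e
  ; pos-root = refl ; inR = λ v → inR' N (proj₁ v) (proj₂ v)
  ; at = λ z z∈ → z , at' N N≤0 z z∈ ; pos-at = λ _ _ → refl }
  where
    pos-inj' : ∀ (u v : Σ[ z ∈ ℤ ] (N ℤ.≤ z)) → proj₁ u ≡ proj₁ v → u ≡ v
    pos-inj' (z , p) (.z , q) refl = cong (z ,_) (ℤP.≤-irrelevant p q)
    inR' : ∀ N z → N ℤ.≤ z → InInterval (fin ℤ.∣ N ∣ , ∞) z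
    inR' N        (+ n)    _                = tt
    inR' -[1+ m ] -[1+ n ] (ℤ.-≤- n≤m)      = s≤s n≤m
    at' : ∀ N → N ℤ.≤ + 0 → ∀ z → InInterval (fin ℤ.∣ N ∣ , ∞) z → N ℤ.≤ z
    at' (+ zero)    _ (+ n)    _          = ℤ.+≤+ z≤n
    at' (+ zero)    _ -[1+ n ] ()
    at' (+ (suc m)) (ℤ.+≤+ ()) _ _
    at' -[1+ m ]    _ (+ n)    _          = ℤ.-≤+
    at' -[1+ m ]    _ -[1+ n ] (s≤s n≤m)  = ℤ.-≤- n≤m

InInterval-neg+ : ∀ L R n → n ≤∞ L → InInterval (L , R) (ℤ.- (+ n))
InInterval-neg+ L R zero    _ = 0∈Interval (L , R)
InInterval-neg+ L R (suc n) p = p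

⊖-injectiveˡ : ∀ {m n} o → m ⊖ o ≡ n ⊖ o → m ≡ n
⊖-injectiveˡ {m} {n} o eq with ℕP.<-cmp m n
... | tri< m<n _ _ = ⊥-elim (ℤP.<-irrefl eq (ℤP.⊖-monoˡ-< o m<n))
... | tri≈ _ m≡n _ = m≡n
... | tri> _ _ n<m = ⊥-elim (ℤP.<-irrefl (sym eq) (ℤP.⊖-monoˡ-< o n<m))

[1+m]⊖n≡m⊖n+1 : ∀ m n → suc m ⊖ n ≡ m ⊖ n ℤ.+ + 1
[1+m]⊖n≡m⊖n+1 m n = trans (cong (_⊖ n) (ℕP.+-comm 1 m)) (sym (ℤP.distribˡ-⊖-+-pos 1 m n))

module _ (k : ℕ) (o : Fin k) where
  private
    O : ℕ
    O = toℕ o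
    P : ℕ∞²
    P = profile (finite k o)

    pos' : Fin k → ℤ
    pos' i = toℕ i ⊖ O

    suc⇒pos+1 : ∀ i j → toℕ j ≡ suc (toℕ i) → pos' j ≡ pos' i ℤ.+ + 1
    suc⇒pos+1 i j eq = trans (cong (_⊖ O) eq) ([1+m]⊖n≡m⊖n+1 (toℕ i) O)

    pos+1⇒suc : ∀ i j → pos' j ≡ pos' i ℤ.+ + 1 → toℕ j ≡ suc (toℕ i)
    pos+1⇒suc i j eq = ⊖-injectiveˡ O (trans eq (sym ([1+m]⊖n≡m⊖n+1 (toℕ i) O)))

    inR' : ∀ i → InInterval P (pos' i)
    inR' i with ℕP.≤-total O (toℕ i)
    ... | inj₁ O≤i = subst (InInterval P) (sym (ℤP.⊖-≥ O≤i)) (ℕP.∸-monoˡ-≤ (suc O) (FinP.toℕ<n i))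
    ... | inj₂ i≤O = subst (InInterval P) (sym (ℤP.⊖-≤ i≤O))
                       (InInterval-neg+ _ _ (O ∸ toℕ i) (ℕP.m∸n≤m O (toℕ i)))

    at' : ∀ z → InInterval P z → Fin k
    at' (+ n)    n≤ = Fin.fromℕ< (begin-strict
      O ℕ.+ n               ≤⟨ ℕP.+-monoʳ-≤ O n≤ ⟩
      O ℕ.+ (k ∸ suc O)     <⟨ ℕP.+-monoˡ-< (k ∸ suc O) (ℕP.n<1+n O) ⟩
      suc O ℕ.+ (k ∸ suc O) ≡⟨ ℕP.m+[n∸m]≡n (FinP.toℕ<n o) ⟩
      k                     ∎)
      where open ℕP.≤-Reasoning
    at' -[1+ n ] _  = Fin.fromℕ< (ℕP.≤-<-trans (ℕP.m∸n≤m O (suc n)) (FinP.toℕ<n o))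

    pos-at' : ∀ z z∈ → pos' (at' z z∈) ≡ z
    pos-at' (+ n) z∈ = begin
      toℕ (at' (+ n) z∈) ⊖ O  ≡⟨ cong (_⊖ O) (FinP.toℕ-fromℕ< _) ⟩
      O ℕ.+ n ⊖ O             ≡⟨ ℤP.⊖-≥ (ℕP.m≤m+n O n) ⟩
      + (O ℕ.+ n ∸ O)         ≡⟨ cong +_ (ℕP.m+n∸m≡n O n) ⟩
      + n                     ∎
      where open ≡-Reasoning
    pos-at' -[1+ n ] 1+n≤O = begin
      toℕ (at' -[1+ n ] 1+n≤O) ⊖ O  ≡⟨ cong (_⊖ O) (FinP.toℕ-fromℕ< _) ⟩
      O ∸ suc n ⊖ O                 ≡⟨ ℤP.⊖-≤ (ℕP.m∸n≤m O (suc n)) ⟩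
      ℤ.- (+ (O ∸ (O ∸ suc n)))     ≡⟨ cong (λ m → ℤ.- (+ m)) (ℕP.m∸[m∸n]≡n 1+n≤O) ⟩
      -[1+ n ]                      ∎
      where open ≡-Reasoning

  pathLike-finite : PathLike (toGraph (finite k o)) P
  pathLike-finite = record
    { pos      = pos'
    ; pos-inj  = λ i j eq → FinP.toℕ-injective (⊖-injectiveˡ O eq)
    ; adj→     = λ { i j (inj₁ eq) → inj₁ (suc⇒pos+1 i j eq) ; i j (inj₂ eq) → inj₂ (suc⇒pos+1 j i eq) }
    ; adj←     = λ { i j (inj₁ eq) → inj₁ (pos+1⇒suc i j eq) ; i j (inj₂ eq) → inj₂ (pos+1⇒suc j i eq) }
    ; pos-root = ℤP.n⊖n≡0 O
    ; inR      = inR'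
    ; at       = at'
    ; pos-at   = pos-at' }

pathLike : ∀ x → PathLike (toGraph x) (profile x)
pathLike (finite k o)    = pathLike-finite k o
pathLike (semiInf N N≤0) = pathLike-semiInf N N≤0
pathLike biInf           = pathLike-biInf

canonical : ℕ∞² → PElem
canonical (fin m , fin M) = finite (suc (m ℕ.+ M)) (Fin.fromℕ< (s≤s (ℕP.m≤m+n m M)))
canonical (fin m , ∞)     = semiInf (ℤ.- (+ m)) ℤP.neg-≤-pos
canonical (∞ , _)         = biInf

profile-canonical : ∀ P → Sorted P → profile (canonical P) ≡ P
profile-canonical (fin m , fin M) _ = cong₂ (λ u v → fin u , fin v) toℕo (begin
  suc (m ℕ.+ M) ∸ suc (toℕ o)  ≡⟨ cong (λ t → m ℕ.+ M ∸ t) toℕo ⟩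
  m ℕ.+ M ∸ m                  ≡⟨ ℕP.m+n∸m≡n m M ⟩
  M                            ∎)
  where
    open ≡-Reasoning
    o = Fin.fromℕ< (s≤s (ℕP.m≤m+n m M))
    toℕo = FinP.toℕ-fromℕ< (s≤s (ℕP.m≤m+n m M))
profile-canonical (fin zero    , ∞) _ = refl
profile-canonical (fin (suc m) , ∞) _ = refl
profile-canonical (∞           , ∞) _ = refl

pathLike-canonical : ∀ P → Sorted P → PathLike (toGraph (canonical P)) P
pathLike-canonical P sorted =
  subst (PathLike (toGraph (canonical P))) (profile-canonical P sorted) (pathLike (canonical P))

canonical-sort-profile : ∀ x → canonical (sort (profile x)) ≅ x
canonical-sort-profile x with sort≡id⊎swap (profile x) | pathLike-canonical _ (sort-sorted (profile x))
... | inj₁ eq | sortedPL = pathLike⇒Iso (subst (PathLike _) eq sortedPL) (pathLike x)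
... | inj₂ eq | sortedPL = pathLike⇒Iso (reflect (subst (PathLike _) eq sortedPL)) (pathLike x)

data Parity (j : ℕ) : Set where
  even : ∀ i → 2 ℕ.* i ≡ j → Parity j
  odd  : ∀ i → suc (2 ℕ.* i) ≡ j → Parity j

parity : ∀ j → Parity j
parity zero = even 0 refl
parity (suc j) with parity j
... | even i eq = odd i (cong suc eq)
... | odd  i eq = even (suc i) (trans (ℕP.*-suc 2 i) (cong suc eq))

2*n≡n+n : ∀ n → 2 ℕ.* n ≡ n ℕ.+ n
2*n≡n+n n = cong (n ℕ.+_) (ℕP.+-identityʳ n)

m≤n⇒m+n≤2*n : ∀ {m n} → m ℕ.≤ n → m ℕ.+ n ℕ.≤ 2 ℕ.* n
m≤n⇒m+n≤2*n {m} {n} m≤n = subst (m ℕ.+ n ℕ.≤_) (sym (2*n≡n+n n)) (ℕP.+-monoˡ-≤ n m≤n)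

infixl 6 _∸∞_

_∸∞_ : ℕ∞ → ℕ → ℕ∞
fin a ∸∞ i = fin (a ∸ i)
∞     ∸∞ i = ∞

toSquare : ℕ∞² → ℕ∞²
toSquare (∞ , _) = ∞ , ∞
toSquare (fin j , M) with parity j
... | even i _ = fin i , M ∸∞ i
... | odd  i _ = M ∸∞ i , fin i

toSquare-even : ∀ i M → toSquare (fin (2 ℕ.* i) , M) ≡ (fin i , M ∸∞ i)
toSquare-even i M with parity (2 ℕ.* i)
... | even i' eq with ℕP.*-cancelˡ-≡ i' i 2 eq
...   | refl = refl
toSquare-even i M | odd i' eq = ⊥-elim (ℕP.even≢odd i i' (sym eq))

toSquare-odd : ∀ i M → toSquare (fin (suc (2 ℕ.* i)) , M) ≡ (M ∸∞ i , fin i)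
toSquare-odd i M with parity (suc (2 ℕ.* i))
... | even i' eq = ⊥-elim (ℕP.even≢odd i' i eq)
... | odd  i' eq with ℕP.*-cancelˡ-≡ i' i 2 (ℕP.suc-injective eq)
...   | refl = refl

toTriangle : ℕ∞² → ℕ∞²
toTriangle (∞     , ∞)     = ∞ , ∞
toTriangle (∞     , fin i) = fin (suc (2 ℕ.* i)) , ∞
toTriangle (fin i , ∞)     = fin (2 ℕ.* i) , ∞
toTriangle (fin a , fin b) with a ℕ.≤? b
... | yes _ = fin (2 ℕ.* a) , fin (b ℕ.+ a)
... | no  _ = fin (suc (2 ℕ.* b)) , fin (a ℕ.+ b)

toTriangle-sorted : ∀ P → Sorted (toTriangle P)
toTriangle-sorted (∞     , ∞)     = tt
toTriangle-sorted (∞     , fin i) = tt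
toTriangle-sorted (fin i , ∞)     = tt
toTriangle-sorted (fin a , fin b) with a ℕ.≤? b
... | yes a≤b = subst (ℕ._≤ b ℕ.+ a) (sym (2*n≡n+n a)) (ℕP.+-monoˡ-≤ a a≤b)
... | no  a≰b = subst (ℕ._≤ a ℕ.+ b) (cong suc (sym (2*n≡n+n b))) (ℕP.+-monoˡ-≤ b (ℕP.≰⇒> a≰b))

toSquare∘toTriangle : ∀ P → toSquare (toTriangle P) ≡ P
toSquare∘toTriangle (∞     , ∞)     = refl
toSquare∘toTriangle (∞     , fin i) = toSquare-odd i ∞
toSquare∘toTriangle (fin i , ∞)     = toSquare-even i ∞
toSquare∘toTriangle (fin a , fin b) with a ℕ.≤? b
... | yes _ = trans (toSquare-even a _) (cong (λ t → fin a , fin t) (ℕP.m+n∸n≡m b a))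
... | no  _ = trans (toSquare-odd b _) (cong (λ t → fin t , fin b) (ℕP.m+n∸n≡m a b))

toTriangle∘toSquare : ∀ P → Sorted P → toTriangle (toSquare P) ≡ P
toTriangle∘toSquare (∞ , ∞) _ = refl
toTriangle∘toSquare (fin j , M) sorted with parity j
toTriangle∘toSquare (fin _ , ∞)     _ | even i refl = refl
toTriangle∘toSquare (fin _ , fin a) 2i≤a | even i refl with i ℕ.≤? a ∸ i
... | yes _   = cong (λ t → fin (2 ℕ.* i) , fin t) (ℕP.m∸n+n≡m (ℕP.≤-trans (ℕP.m≤m+n i _) 2i≤a))
... | no  i≰ = ⊥-elim (i≰ (ℕP.≤-trans (ℕP.≤-reflexive (sym (ℕP.m+n∸n≡m i i)))
                          (ℕP.∸-monoˡ-≤ i (subst (ℕ._≤ a) (2*n≡n+n i) 2i≤a))))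
toTriangle∘toSquare (fin _ , ∞)     _ | odd i refl = refl
toTriangle∘toSquare (fin _ , fin a) 2i<a | odd i refl with a ∸ i ℕ.≤? i
... | yes ≤i = ⊥-elim (ℕP.<-irrefl refl (ℕP.≤-trans i<a∸i ≤i))
  where
    i<a∸i : suc i ℕ.≤ a ∸ i
    i<a∸i = ℕP.≤-trans (ℕP.≤-reflexive (sym (ℕP.m+n∸n≡m (suc i) i)))
              (ℕP.∸-monoˡ-≤ i (subst (λ t → suc t ℕ.≤ a) (2*n≡n+n i) 2i<a))
... | no  _  = cong (λ t → fin (suc (2 ℕ.* i)) , fin t)
                 (ℕP.m∸n+n≡m (ℕP.≤-trans (ℕP.≤-trans (ℕP.m≤m+n i _) (ℕP.n≤1+n _)) 2i<a))

≤∞⇒≤∞∸∞ : ∀ M i K → i ℕ.+ K ≤∞ M → K ≤∞ M ∸∞ i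
≤∞⇒≤∞∸∞ (fin a) i K i+K≤a = subst (ℕ._≤ a ∸ i) (ℕP.m+n∸m≡n i K) (ℕP.∸-monoˡ-≤ i i+K≤a)
≤∞⇒≤∞∸∞ ∞       i K _     = tt

agree-∸∞ : ∀ M M' i {K S} → i ℕ.+ K ℕ.≤ S → Agree S M M' → Agree K (M ∸∞ i) (M' ∸∞ i)
agree-∸∞ M M' i i+K≤S agree with agree⇒≡⊎≤∞ M M' agree
... | inj₁ refl    = refl
... | inj₂ (p , q) = ≤∞⇒agree (M ∸∞ i) (M' ∸∞ i)
                       (≤∞⇒≤∞∸∞ M i _ (≤-≤∞-trans M i+K≤S p)) (≤∞⇒≤∞∸∞ M' i _ (≤-≤∞-trans M' i+K≤S q))

toSquare-≥ : ∀ K P → Sorted P → 2 ℕ.* K ≤∞ proj₁ P → K ≤∞ proj₁ (toSquare P) × K ≤∞ proj₂ (toSquare P)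
toSquare-≥ K (∞ , ∞) _ _ = tt , tt
toSquare-≥ K (fin j , M) sorted 2K≤j with parity j
... | even i refl = K≤i , ≤∞⇒≤∞∸∞ M i K (sorted⇒≤∞ (fin (2 ℕ.* i) , M) sorted i+K≤2i)
  where
    K≤i = ℕP.*-cancelˡ-≤ 2 2K≤j
    i+K≤2i = subst (ℕ._≤ 2 ℕ.* i) (ℕP.+-comm K i) (m≤n⇒m+n≤2*n K≤i)
... | odd  i refl = ≤∞⇒≤∞∸∞ M i K (sorted⇒≤∞ (fin (suc (2 ℕ.* i)) , M) sorted i+K≤1+2i) , K≤i
  where
    K≤i : K ℕ.≤ i
    K≤i = ℕP.≤-pred (ℕP.*-cancelˡ-< 2 K (suc i)
            (ℕP.≤-<-trans 2K≤j (subst (suc (2 ℕ.* i) ℕ.<_) (sym (ℕP.*-suc 2 i)) (ℕP.n<1+n _))))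
    i+K≤1+2i = ℕP.≤-trans (subst (ℕ._≤ 2 ℕ.* i) (ℕP.+-comm K i) (m≤n⇒m+n≤2*n K≤i)) (ℕP.n≤1+n _)

toSquare-agree-≥ : ∀ K P P' → Sorted P → Sorted P' → 2 ℕ.* K ≤∞ proj₁ P → 2 ℕ.* K ≤∞ proj₁ P' →
                   Agree² K (toSquare P) (toSquare P')
toSquare-agree-≥ K P P' sorted sorted' p p' =
  let q , r = toSquare-≥ K P sorted p ; q' , r' = toSquare-≥ K P' sorted' p'
  in ≤∞⇒agree _ _ q q' , ≤∞⇒agree _ _ r r'

toSquare-agree-< : ∀ K j M M' → j ℕ.< 2 ℕ.* K → Agree (2 ℕ.* K) M M' →
                   Agree² K (toSquare (fin j , M)) (toSquare (fin j , M'))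
toSquare-agree-< K j M M' j<2K agree with parity j
... | even i refl = refl , agree-∸∞ M M' i (m≤n⇒m+n≤2*n (ℕP.*-cancelˡ-≤ {i} {K} 2 (ℕP.<⇒≤ j<2K))) agree
... | odd  i refl = agree-∸∞ M M' i (m≤n⇒m+n≤2*n (ℕP.*-cancelˡ-≤ {i} {K} 2 (ℕP.≤-trans (ℕP.n≤1+n _) (ℕP.<⇒≤ j<2K)))) agree
                  , refl

toSquare-agree : ∀ K P P' → Sorted P → Sorted P' → Agree² (2 ℕ.* K) P P' → Agree² K (toSquare P) (toSquare P')
toSquare-agree K (m , M) (m' , M') sorted sorted' (agree-m , agree-M) with agree⇒≡⊎≤∞ m m' agree-m
... | inj₂ (p , p') = toSquare-agree-≥ K (m , M) (m' , M') sorted sorted' p p'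
toSquare-agree K (∞     , M) (∞ , M') _ _ _ | inj₁ refl = refl , refl
toSquare-agree K (fin j , M) (_ , M') sorted sorted' (_ , agree-M) | inj₁ refl with 2 ℕ.* K ℕ.≤? j
... | yes 2K≤j = toSquare-agree-≥ K (fin j , M) (fin j , M') sorted sorted' 2K≤j 2K≤j
... | no  2K≰j = toSquare-agree-< K j M M' (ℕP.≰⇒> 2K≰j) agree-M

toαℕ : ℕ∞ → ℚ
toαℕ (fin n) = + 1 / suc n
toαℕ ∞       = 0ℚ

toαℕ-InαN : ∀ u → InαN (toαℕ u)
toαℕ-InαN (fin n) = inj₂ (n , refl)
toαℕ-InαN ∞       = inj₁ refl

fromαℕ : ∀ q → InαN q → ℕ∞
fromαℕ q (inj₁ _)       = ∞
fromαℕ q (inj₂ (n , _)) = fin n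

toαℕ∘fromαℕ : ∀ q q∈ → toαℕ (fromαℕ q q∈) ≡ q
toαℕ∘fromαℕ q (inj₁ eq)       = sym eq
toαℕ∘fromαℕ q (inj₂ (n , eq)) = sym eq

fromαℕ∘toαℕ : ∀ u → fromαℕ (toαℕ u) (toαℕ-InαN u) ≡ u
fromαℕ∘toαℕ (fin n) = refl
fromαℕ∘toαℕ ∞       = refl

toαℕ² : ℕ∞² → αN²
toαℕ² (u , v) = (toαℕ u , toαℕ v) , (toαℕ-InαN u , toαℕ-InαN v)

fromαℕ² : αN² → ℕ∞²
fromαℕ² ((q , r) , (q∈ , r∈)) = fromαℕ q q∈ , fromαℕ r r∈

fromαℕ²∘toαℕ² : ∀ P → fromαℕ² (toαℕ² P) ≡ P
fromαℕ²∘toαℕ² (u , v) = cong₂ _,_ (fromαℕ∘toαℕ u) (fromαℕ∘toαℕ v)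

toαℕ²∘fromαℕ² : ∀ a → proj₁ (toαℕ² (fromαℕ² a)) ≡ proj₁ a
toαℕ²∘fromαℕ² ((q , r) , (q∈ , r∈)) = cong₂ _,_ (toαℕ∘fromαℕ q q∈) (toαℕ∘fromαℕ r r∈)

toαℕ-normal : ∀ n → toαℕ (fin n) ≡ mkℚ (+ 1) n (1-coprimeTo (suc n))
toαℕ-normal n = ℚP.normalize-coprime (1-coprimeTo (suc n))

toαℕ-pos : ∀ n → 0ℚ < toαℕ (fin n)
toαℕ-pos n = subst (0ℚ <_) (sym (toαℕ-normal n)) (*<* (ℤ.+<+ (s≤s z≤n)))

toαℕ-nonneg : ∀ u → 0ℚ ≤ toαℕ u
toαℕ-nonneg (fin n) = ℚP.<⇒≤ (toαℕ-pos n)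
toαℕ-nonneg ∞       = ℚP.≤-refl

toαℕ-antimono-< : ∀ {n m} → n ℕ.< m → toαℕ (fin m) < toαℕ (fin n)
toαℕ-antimono-< {n} {m} n<m = subst₂ _<_ (sym (toαℕ-normal m)) (sym (toαℕ-normal n))
  (*<* (subst₂ ℤ._<_ (sym (ℤP.*-identityˡ (+ suc n))) (sym (ℤP.*-identityˡ (+ suc m))) (ℤ.+<+ (s≤s n<m))))

toαℕ-antimono-≤ : ∀ {n m} → n ℕ.≤ m → toαℕ (fin m) ≤ toαℕ (fin n)
toαℕ-antimono-≤ {n} {m} n≤m = subst₂ _≤_ (sym (toαℕ-normal m)) (sym (toαℕ-normal n))
  (*≤* (subst₂ ℤ._≤_ (sym (ℤP.*-identityˡ (+ suc n))) (sym (ℤP.*-identityˡ (+ suc m))) (ℤ.+≤+ (s≤s n≤m))))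

≤∞⇒toαℕ-≤ : ∀ K u → K ≤∞ u → toαℕ u ≤ toαℕ (fin K)
≤∞⇒toαℕ-≤ K (fin n) K≤n = toαℕ-antimono-≤ K≤n
≤∞⇒toαℕ-≤ K ∞       _   = toαℕ-nonneg (fin K)

toαℕ-injective : ∀ u u' → toαℕ u ≡ toαℕ u' → u ≡ u'
toαℕ-injective (fin n) (fin m) eq with ℕP.<-cmp n m
... | tri< n<m _ _ = ⊥-elim (ℚP.<⇒≢ (toαℕ-antimono-< n<m) (sym eq))
... | tri≈ _ refl _ = refl
... | tri> _ _ m<n = ⊥-elim (ℚP.<⇒≢ (toαℕ-antimono-< m<n) eq)
toαℕ-injective (fin n) ∞       eq = ⊥-elim (ℚP.<⇒≢ (toαℕ-pos n) (sym eq))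
toαℕ-injective ∞       (fin m) eq = ⊥-elim (ℚP.<⇒≢ (toαℕ-pos m) eq)
toαℕ-injective ∞       ∞       _  = refl

toαℕ-archimedean : ∀ ε → 0ℚ < ε → Σ[ K ∈ ℕ ] toαℕ (fin K) < ε
toαℕ-archimedean (mkℚ (+ zero)    d _) (*<* (ℤ.+<+ ()))
toαℕ-archimedean (mkℚ -[1+ p ]    d _) (*<* ())
toαℕ-archimedean (mkℚ (+ (suc p)) d c) _ = suc d ,
  subst (_< mkℚ (+ (suc p)) d c) (sym (toαℕ-normal (suc d)))
    (*<* (subst₂ ℤ._<_ (sym (ℤP.*-identityˡ (+ suc d))) (ℤP.pos-* (suc p) (suc (suc d)))
      (ℤ.+<+ (s≤s (s≤s (ℕP.m≤m+n d _))))))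

p≤∣p∣ : ∀ p → p ≤ ∣ p ∣ℚ
p≤∣p∣ p with ℚP.≤-total 0ℚ p
... | inj₁ 0≤p = ℚP.≤-reflexive (sym (ℚP.0≤p⇒∣p∣≡p 0≤p))
... | inj₂ p≤0 = ℚP.≤-trans p≤0 (ℚP.0≤∣p∣ p)

∣p-q∣≡∣q-p∣ : ∀ p q → ∣ p - q ∣ℚ ≡ ∣ q - p ∣ℚ
∣p-q∣≡∣q-p∣ p q = trans (sym (ℚP.∣-p∣≡∣p∣ (p - q))) (cong ∣_∣ℚ (⁻¹-anti-homo-// p q))

p-q≤p : ∀ p q → 0ℚ ≤ q → p - q ≤ p
p-q≤p p q 0≤q = subst (p - q ≤_) (ℚP.+-identityʳ p) (ℚP.+-monoʳ-≤ p (ℚP.neg-antimono-≤ 0≤q))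

∣p-q∣≤r : ∀ p q r → 0ℚ ≤ p → p ≤ r → 0ℚ ≤ q → q ≤ r → ∣ p - q ∣ℚ ≤ r
∣p-q∣≤r p q r 0≤p p≤r 0≤q q≤r with ℚP.∣p∣≡p∨∣p∣≡-p (p - q)
... | inj₁ eq = subst (_≤ r) (sym eq) (ℚP.≤-trans (p-q≤p p q 0≤q) p≤r)
... | inj₂ eq = subst (_≤ r) (sym (trans eq (⁻¹-anti-homo-// p q))) (ℚP.≤-trans (p-q≤p q p 0≤p) q≤r)

p<q⇒0<q-p : ∀ {p q} → p < q → 0ℚ < q - p
p<q⇒0<q-p {p} {q} p<q = subst (_< q - p) (ℚP.+-inverseʳ p) (ℚP.+-monoˡ-< (- p) p<q)

⊓-pos : ∀ p q → 0ℚ < p → 0ℚ < q → 0ℚ < p ⊓ℚ q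
⊓-pos p q 0<p 0<q with ℚP.⊓-sel p q
... | inj₁ eq = subst (0ℚ <_) (sym eq) 0<p
... | inj₂ eq = subst (0ℚ <_) (sym eq) 0<q

agree⇒∣toαℕ-toαℕ∣≤ : ∀ K u u' → Agree K u u' → ∣ toαℕ u - toαℕ u' ∣ℚ ≤ toαℕ (fin K)
agree⇒∣toαℕ-toαℕ∣≤ K u u' agree with agree⇒≡⊎≤∞ u u' agree
... | inj₁ refl = subst (_≤ toαℕ (fin K)) (sym (cong ∣_∣ℚ (ℚP.+-inverseʳ (toαℕ u)))) (toαℕ-nonneg (fin K))
... | inj₂ (p , q) =
  ∣p-q∣≤r _ _ _ (toαℕ-nonneg u) (≤∞⇒toαℕ-≤ K u p) (toαℕ-nonneg u') (≤∞⇒toαℕ-≤ K u' q)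

-- Every point of αℕ other than 1/(n+1) is at distance at least isolation n from it.
isolation : ℕ → ℚ
isolation zero    = toαℕ (fin 0) - toαℕ (fin 1)
isolation (suc n) = (toαℕ (fin (suc n)) - toαℕ (fin (suc (suc n)))) ⊓ℚ (toαℕ (fin n) - toαℕ (fin (suc n)))

isolation-pos : ∀ n → 0ℚ < isolation n
isolation-pos zero    = p<q⇒0<q-p (toαℕ-antimono-< (ℕP.n<1+n 0))
isolation-pos (suc n) =
  ⊓-pos _ _ (p<q⇒0<q-p (toαℕ-antimono-< (ℕP.n<1+n (suc n)))) (p<q⇒0<q-p (toαℕ-antimono-< (ℕP.n<1+n n)))

isolation≤gapAbove : ∀ n → isolation n ≤ toαℕ (fin n) - toαℕ (fin (suc n))
isolation≤gapAbove zero    = ℚP.≤-refl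
isolation≤gapAbove (suc n) = ℚP.p⊓q≤p _ _

isolation≤distAbove : ∀ n u' → toαℕ u' ≤ toαℕ (fin (suc n)) → isolation n ≤ ∣ toαℕ (fin n) - toαℕ u' ∣ℚ
isolation≤distAbove n u' u'≤ = ℚP.≤-trans (isolation≤gapAbove n)
  (ℚP.≤-trans (ℚP.+-monoʳ-≤ (toαℕ (fin n)) (ℚP.neg-antimono-≤ u'≤)) (p≤∣p∣ _))

isolation≤distBelow : ∀ n m → m ℕ.≤ n → isolation (suc n) ≤ ∣ toαℕ (fin (suc n)) - toαℕ (fin m) ∣ℚ
isolation≤distBelow n m m≤n =
  ℚP.≤-trans (ℚP.p⊓q≤q (toαℕ (fin (suc n)) - toαℕ (fin (suc (suc n)))) (toαℕ (fin n) - toαℕ (fin (suc n))))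
  (ℚP.≤-trans (ℚP.+-monoˡ-≤ (- toαℕ (fin (suc n))) (toαℕ-antimono-≤ m≤n))
  (ℚP.≤-trans (p≤∣p∣ _) (ℚP.≤-reflexive (∣p-q∣≡∣q-p∣ (toαℕ (fin m)) (toαℕ (fin (suc n)))))))

Near : ℕ → ℕ∞ → ℕ∞ → Set
Near T (fin n) u' = u' ≡ fin n
Near T ∞       u' = T ≤∞ u'

nearRadius : ℕ → ℕ∞ → ℚ
nearRadius T (fin n) = isolation n
nearRadius T ∞       = toαℕ (fin T)

nearRadius-pos : ∀ T u → 0ℚ < nearRadius T u
nearRadius-pos T (fin n) = isolation-pos n
nearRadius-pos T ∞       = toαℕ-pos T

close⇒near : ∀ T u u' → ∣ toαℕ u - toαℕ u' ∣ℚ < nearRadius T u → Near T u u'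
close⇒near T ∞ ∞ _ = tt
close⇒near T ∞ (fin m) close with T ℕ.≤? m
... | yes T≤m = T≤m
... | no  T≰m = ⊥-elim (ℚP.<-irrefl refl (ℚP.<-≤-trans (subst (_< toαℕ (fin T)) ∣0-p∣≡p close)
                                              (toαℕ-antimono-≤ (ℕP.<⇒≤ (ℕP.≰⇒> T≰m)))))
  where
    ∣0-p∣≡p : ∣ 0ℚ - toαℕ (fin m) ∣ℚ ≡ toαℕ (fin m)
    ∣0-p∣≡p = trans (cong ∣_∣ℚ (ℚP.+-identityˡ (- toαℕ (fin m))))
                (trans (ℚP.∣-p∣≡∣p∣ (toαℕ (fin m))) (ℚP.0≤p⇒∣p∣≡p (toαℕ-nonneg (fin m))))
close⇒near T (fin n) ∞ close =
  ⊥-elim (ℚP.<-irrefl refl (ℚP.<-≤-trans close (isolation≤distAbove n ∞ (toαℕ-nonneg (fin (suc n))))))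
close⇒near T (fin n) (fin m) close with ℕP.<-cmp n m
... | tri≈ _ refl _ = refl
... | tri< n<m _ _ = ⊥-elim (ℚP.<-irrefl refl (ℚP.<-≤-trans close (isolation≤distAbove n (fin m) (toαℕ-antimono-≤ n<m))))
close⇒near T (fin (suc n)) (fin m) close | tri> _ _ m<1+n =
  ⊥-elim (ℚP.<-irrefl refl (ℚP.<-≤-trans close (isolation≤distBelow n m (ℕP.≤-pred m<1+n))))
close⇒near T (fin zero) (fin m) close | tri> _ _ ()

toTriangle-≥ : ∀ K u v → K ≤∞ u → K ≤∞ v → K ≤∞ proj₁ (toTriangle (u , v)) × K ≤∞ proj₂ (toTriangle (u , v))
toTriangle-≥ K ∞       ∞       _   _   = tt , tt
toTriangle-≥ K ∞       (fin i) _   K≤i = ℕP.≤-trans K≤i (ℕP.≤-trans (ℕP.m≤m+n i _) (ℕP.n≤1+n _)) , tt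
toTriangle-≥ K (fin i) ∞       K≤i _   = ℕP.≤-trans K≤i (ℕP.m≤m+n i _) , tt
toTriangle-≥ K (fin a) (fin b) K≤a K≤b with a ℕ.≤? b
... | yes _ = ℕP.≤-trans K≤a (ℕP.m≤m+n a _) , ℕP.≤-trans K≤b (ℕP.m≤m+n b a)
... | no  _ = ℕP.≤-trans K≤b (ℕP.≤-trans (ℕP.m≤m+n b _) (ℕP.n≤1+n _)) , ℕP.≤-trans K≤a (ℕP.m≤m+n a b)

-- The junk value 0 at ∞ is harmless: it only enters the choice of a large enough level.
finitePart : ℕ∞ → ℕ
finitePart (fin n) = n
finitePart ∞       = 0

near⇒toTriangle-agree : ∀ K T u v u' v' → K ℕ.≤ T → finitePart u ℕ.< T → finitePart v ℕ.< T →
  Near T u u' → Near T v v' → Agree² K (toTriangle (u , v)) (toTriangle (u' , v'))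
near⇒toTriangle-agree K T (fin a) (fin b) _ _ _ _ _ refl refl = refl , refl
near⇒toTriangle-agree K T (fin i) ∞ _ ∞       _ _ _ refl _ = refl , refl
near⇒toTriangle-agree K T (fin i) ∞ _ (fin b) K≤T i<T _ refl T≤b with i ℕ.≤? b
... | yes _   = refl , sym (s≤∞x⇒x⊓∞s≡s (fin (b ℕ.+ i)) (ℕP.≤-trans (ℕP.≤-trans K≤T T≤b) (ℕP.m≤m+n b i)))
... | no  i≰b = ⊥-elim (i≰b (ℕP.<⇒≤ (ℕP.<-≤-trans i<T T≤b)))
near⇒toTriangle-agree K T ∞ (fin i) ∞       _ _ _ _ _ refl = refl , refl
near⇒toTriangle-agree K T ∞ (fin i) (fin a) _ K≤T _ i<T T≤a refl with a ℕ.≤? i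
... | yes a≤i = ⊥-elim (ℕP.<-irrefl refl (ℕP.<-≤-trans i<T (ℕP.≤-trans T≤a a≤i)))
... | no  _   = refl , sym (s≤∞x⇒x⊓∞s≡s (fin (a ℕ.+ i)) (ℕP.≤-trans (ℕP.≤-trans K≤T T≤a) (ℕP.m≤m+n a i)))
near⇒toTriangle-agree K T ∞ ∞ u' v' K≤T _ _ T≤u' T≤v' =
  let p , q = toTriangle-≥ K u' v' (≤-≤∞-trans u' K≤T T≤u') (≤-≤∞-trans v' K≤T T≤v')
  in sym (s≤∞x⇒x⊓∞s≡s _ p) , sym (s≤∞x⇒x⊓∞s≡s _ q)

BallIso-canonical⇒agree² : ∀ W W' → Sorted W → Sorted W' →
  ∀ s → BallIso (toGraph (canonical W)) (toGraph (canonical W')) s → Agree² s W W'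
BallIso-canonical⇒agree² W W' sorted sorted' s I =
  subst₂ (Agree² s) (sorted⇒sort≡id W sorted) (sorted⇒sort≡id W' sorted') (BallIso⇒agree-sorted (pathLike-canonical W sorted) (pathLike-canonical W' sorted') I)

ρ-canonical : ∀ W W' → Sorted W → Sorted W' →
  Σ[ q ∈ ℚ ] (ρ≡ (canonical W) (canonical W') q × (∀ K → Agree² K W W' → q ≤ toαℕ (fin K)))
ρ-canonical W W' sorted sorted' with agreementLevel² W W' in level≡
... | ∞ = 0ℚ , inj₁ (subst (λ t → canonical W ≅ canonical t) (level²≡∞⇒≡ W W' level≡) (Iso-refl _) , refl)
             , λ K _ → toαℕ-nonneg (fin K)
... | fin r = toαℕ (fin r) , inj₂ (¬iso , inj₁ (r , (ballIso-r , maximal) , refl))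
                           , λ K agree → toαℕ-antimono-≤ (agree⇒≤r K agree)
  where
    agree⇒≤r : ∀ s → Agree² s W W' → s ℕ.≤ r
    agree⇒≤r s agree = subst (s ≤∞_) level≡ (agree²⇒≤∞level² W W' agree)
    maximal : ∀ s → BallIso (toGraph (canonical W)) (toGraph (canonical W')) s → s ℕ.≤ r
    maximal s I = agree⇒≤r s (BallIso-canonical⇒agree² W W' sorted sorted' s I)
    ¬iso : ¬ (canonical W ≅ canonical W')
    ¬iso I = ℕP.1+n≰n (maximal (suc r) (Iso⇒BallIso I (suc r)))
    ballIso-r : BallIso (toGraph (canonical W)) (toGraph (canonical W')) r
    ballIso-r = pathLike⇒BallIso (pathLike-canonical W sorted) (pathLike-canonical W' sorted') r
      (let agree , agree' = ≤∞level²⇒agree² W W' (subst (r ≤∞_) (sym level≡) ℕP.≤-refl)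
       in cong₂ (λ u v → fin u , fin v) agree agree')

ρ<⇒BallIso : ∀ x y q S → ρ≡ x y q → q < toαℕ (fin S) →
             Σ[ s ∈ ℕ ] (S ℕ.≤ s × BallIso (toGraph x) (toGraph y) s)
ρ<⇒BallIso x y q S (inj₁ (I , _)) _ = S , ℕP.≤-refl , Iso⇒BallIso I S
ρ<⇒BallIso x y q S (inj₂ (_ , inj₁ (r , (I , _) , refl))) q<δ with S ℕ.≤? r
... | yes S≤r = r , S≤r , I
... | no  S≰r = ⊥-elim (ℚP.<-irrefl refl (ℚP.<-trans q<δ (toαℕ-antimono-< (ℕP.≰⇒> S≰r))))
ρ<⇒BallIso x y q S (inj₂ (_ , inj₂ (unbounded , _))) _ = unbounded S

ρ<⇒agree-sorted-profiles : ∀ x y q S → ρ≡ x y q → q < toαℕ (fin S) →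
                           Agree² S (sort (profile x)) (sort (profile y))
ρ<⇒agree-sorted-profiles x y q S ρxy q<δ =
  let s , S≤s , I = ρ<⇒BallIso x y q S ρxy q<δ
  in agree²-mono (sort (profile x)) (sort (profile y)) S≤s (BallIso⇒agree-sorted (pathLike x) (pathLike y) I)

encode : PElem → αN²
encode x = toαℕ² (toSquare (sort (profile x)))

decode : αN² → PElem
decode a = canonical (toTriangle (fromαℕ² a))

encode-cong : ∀ x y → x ≅ y → proj₁ (encode x) ≡ proj₁ (encode y)
encode-cong x y I = cong (λ P → proj₁ (toαℕ² (toSquare P))) (agree²-all⇒≡ (sort (profile x)) (sort (profile y))
  (λ s → BallIso⇒agree-sorted (pathLike x) (pathLike y) (Iso⇒BallIso I s)))

decode-cong : ∀ a b → proj₁ a ≡ proj₁ b → decode a ≅ decode b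
decode-cong a@((q , r) , (q∈ , r∈)) b@((q' , r') , (q'∈ , r'∈)) eq =
  subst (λ P → decode a ≅ canonical (toTriangle P)) fromαℕ²-eq (Iso-refl _)
  where
    fromαℕ-eq : ∀ p p' p∈ p'∈ → p ≡ p' → fromαℕ p p∈ ≡ fromαℕ p' p'∈
    fromαℕ-eq p p' p∈ p'∈ p≡p' =
      toαℕ-injective _ _ (trans (toαℕ∘fromαℕ p p∈) (trans p≡p' (sym (toαℕ∘fromαℕ p' p'∈))))
    fromαℕ²-eq : fromαℕ² a ≡ fromαℕ² b
    fromαℕ²-eq = cong₂ _,_ (fromαℕ-eq q q' q∈ q'∈ (cong proj₁ eq)) (fromαℕ-eq r r' r∈ r'∈ (cong proj₂ eq))

decode∘encode : ∀ x → decode (encode x) ≅ x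
decode∘encode x = subst (_≅ x) (sym (cong canonical (begin
  toTriangle (fromαℕ² (toαℕ² (toSquare P)))  ≡⟨ cong toTriangle (fromαℕ²∘toαℕ² (toSquare P)) ⟩
  toTriangle (toSquare P)                    ≡⟨ toTriangle∘toSquare P (sort-sorted (profile x)) ⟩
  P                                          ∎))) (canonical-sort-profile x)
  where
    open ≡-Reasoning
    P = sort (profile x)

encode∘decode : ∀ a → proj₁ (encode (decode a)) ≡ proj₁ a
encode∘decode a = trans (cong (λ P → proj₁ (toαℕ² P)) (begin
  toSquare (sort (profile (canonical W)))  ≡⟨ cong (λ P → toSquare (sort P)) (profile-canonical W sorted) ⟩
  toSquare (sort W)                        ≡⟨ cong toSquare (sorted⇒sort≡id W sorted) ⟩
  toSquare W                               ≡⟨ toSquare∘toTriangle (fromαℕ² a) ⟩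
  fromαℕ² a                                ∎)) (toαℕ²∘fromαℕ² a)
  where
    open ≡-Reasoning
    W = toTriangle (fromαℕ² a)
    sorted = toTriangle-sorted (fromαℕ² a)

agree²⇒d∞≤ : ∀ K P P' → Agree² K P P' → d∞ (toαℕ² P) (toαℕ² P') ≤ toαℕ (fin K)
agree²⇒d∞≤ K (u , v) (u' , v') (agree , agree') =
  ℚP.⊔-lub (agree⇒∣toαℕ-toαℕ∣≤ K u u' agree) (agree⇒∣toαℕ-toαℕ∣≤ K v v' agree')

encode-continuous : ContinuousP→α encode
encode-continuous x ε 0<ε =
  let K , toαℕK<ε = toαℕ-archimedean ε 0<ε
  in toαℕ (fin (2 ℕ.* K)) , toαℕ-pos (2 ℕ.* K) , λ y q ρxy q<δ →
     let P = sort (profile x) ; P' = sort (profile y) in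
     ℚP.≤-<-trans (agree²⇒d∞≤ K (toSquare P) (toSquare P')
                    (toSquare-agree K P P' (sort-sorted (profile x)) (sort-sorted (profile y))
                      (ρ<⇒agree-sorted-profiles x y q (2 ℕ.* K) ρxy q<δ)))
                  toαℕK<ε

d∞<⇒near : ∀ T a b → d∞ a b < nearRadius T (proj₁ (fromαℕ² a)) ⊓ℚ nearRadius T (proj₂ (fromαℕ² a)) →
           Near T (proj₁ (fromαℕ² a)) (proj₁ (fromαℕ² b)) × Near T (proj₂ (fromαℕ² a)) (proj₂ (fromαℕ² b))
d∞<⇒near T ((q , r) , (q∈ , r∈)) ((q' , r') , (q'∈ , r'∈)) d<δ =
  near q q∈ q' q'∈ (ℚP.≤-<-trans (ℚP.p≤p⊔q ∣ q - q' ∣ℚ ∣ r - r' ∣ℚ) (ℚP.<-≤-trans d<δ (ℚP.p⊓q≤p δ₁ δ₂))) ,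
  near r r∈ r' r'∈ (ℚP.≤-<-trans (ℚP.p≤q⊔p ∣ q - q' ∣ℚ ∣ r - r' ∣ℚ) (ℚP.<-≤-trans d<δ (ℚP.p⊓q≤q δ₁ δ₂)))
  where
    δ₁ = nearRadius T (fromαℕ q q∈)
    δ₂ = nearRadius T (fromαℕ r r∈)
    near : ∀ p p∈ p' p'∈ → ∣ p - p' ∣ℚ < nearRadius T (fromαℕ p p∈) → Near T (fromαℕ p p∈) (fromαℕ p' p'∈)
    near p p∈ p' p'∈ close = close⇒near T (fromαℕ p p∈) (fromαℕ p' p'∈)
      (subst₂ (λ x x' → ∣ x - x' ∣ℚ < nearRadius T (fromαℕ p p∈)) (sym (toαℕ∘fromαℕ p p∈)) (sym (toαℕ∘fromαℕ p' p'∈)) close)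

decode-continuous : Continuousα→P decode
decode-continuous a ε 0<ε =
  nearRadius T u ⊓ℚ nearRadius T v , ⊓-pos _ _ (nearRadius-pos T u) (nearRadius-pos T v) , λ b d<δ →
    let near-u , near-v = d∞<⇒near T a b d<δ
        agree = near⇒toTriangle-agree K T u v _ _ K≤T u<T v<T near-u near-v
        q , ρab , q≤ = ρ-canonical _ _ (toTriangle-sorted (fromαℕ² a)) (toTriangle-sorted (fromαℕ² b))
    in q , ρab , ℚP.≤-<-trans (q≤ K agree) toαℕK<ε
  where
    K = proj₁ (toαℕ-archimedean ε 0<ε)
    toαℕK<ε = proj₂ (toαℕ-archimedean ε 0<ε)
    u = proj₁ (fromαℕ² a)
    v = proj₂ (fromαℕ² a)
    T = suc (K ℕ.+ finitePart u ℕ.+ finitePart v)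
    K≤T : K ℕ.≤ T
    K≤T = ℕP.≤-trans (ℕP.m≤m+n K _) (ℕP.≤-trans (ℕP.m≤m+n _ _) (ℕP.n≤1+n _))
    u<T : finitePart u ℕ.< T
    u<T = s≤s (ℕP.≤-trans (ℕP.m≤n+m _ K) (ℕP.m≤m+n _ _))
    v<T : finitePart v ℕ.< T
    v<T = s≤s (ℕP.m≤n+m _ _)

mainTheorem19 : Homeomorphic
mainTheorem19 = encode , decode , encode-cong , decode-cong , decode∘encode , encode∘decode
              , encode-continuous , decode-continuous
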